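{- For every formula $\varphi\in\mathbb{F}_{\varepsilon_0}$, every $n<\omega$ and every $\alpha$ with $0<\alpha<\varepsilon_0$, the sequent $\varphi\vdash\langle n^\alpha\rangle\varphi$ is not derivable in $\mathbf{TSC}$.
   Context: Ordinals range below $\varepsilon_0$. $\mathbb{F}_{\varepsilon_0}$ is the least set containing $\top$, closed under $\wedge$ and under unary modalities $\langle n^\alpha\rangle$ ($n<\omega$, $\alpha<\varepsilon_0$); by convention $\langle n^0\rangle\varphi$ denotes $\varphi$. Hyper-exponentials: $e^0=\mathrm{id}$, $e^1(\alpha)=-1+\omega^\alpha$, $e^{n+m}=e^n\circ e^m$. MNF is the least set with: $\top\in$ MNF; each monomial $\langle n^\alpha\rangle\top\in$ MNF; if $\langle n_0^{\alpha_0}\rangle\top\wedge\cdots\wedge\langle n_k^{\alpha_k}\rangle\top\in$ MNF, $n<n_0$, and $\alpha=e^{n_0-n}(\alpha_0)\cdot(2+\beta)$ for some $\beta<\varepsilon_0$, then $\langle n^\alpha\rangle\top\wedge\langle n_0^{\alpha_0}\rangle\top\wedge\cdots\wedge\langle n_k^{\alpha_k}\rangle\top\in$ MNF. $\mathbf{TSC}$ derives sequents $\varphi\vdash\psi$; $\varphi\equiv\psi$ means both directions derivable. Axioms: $\varphi\vdash\varphi$; $\varphi\vdash\top$; $\varphi\wedge\psi\vdash\varphi$; $\varphi\wedge\psi\vdash\psi$; $\langle n^\alpha\rangle\varphi\vdash\langle n^\beta\rangle\varphi$ for $\beta\le\alpha$; $\langle n^{\alpha+\beta}\rangle\varphi\equiv\langle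 n^\beta\rangle\langle n^\alpha\rangle\varphi$; $\langle(m+n)^\alpha\rangle\varphi\vdash\langle m^{e^n(\alpha)}\rangle\varphi$; Schmerl axioms $\langle n^\alpha\rangle(\langle n_0^{\alpha_0}\rangle\top\wedge\cdots\wedge\langle n_k^{\alpha_k}\rangle\top)\equiv\langle n^{e^{n_0-n}(\alpha_0)\cdot(1+\alpha)}\rangle\top\wedge\langle n_0^{\alpha_0}\rangle\top\wedge\cdots\wedge\langle n_k^{\alpha_k}\rangle\top$ for $n<n_0$ and the conjunction in MNF. Rules: from $\varphi\vdash\psi$, $\varphi\vdash\chi$ infer $\varphi\vdash\psi\wedge\chi$; from $\varphi\vdash\psi$, $\psi\vdash\chi$ infer $\varphi\vdash\chi$; from $\varphi\vdash\psi$ infer $\langle n^\alpha\rangle\varphi\vdash\langle n^\alpha\rangle\psi$; from $\varphi\vdash\psi$ infer $\langle n^\alpha\rangle\varphi\wedge\langle m^{\beta+1}\rangle\psi\vdash\langle n^\alpha\rangle(\varphi\wedge\langle m^{\beta+1}\rangle\psi)$ for $m<n$. -}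

module Defs where

open import Data.Nat using (ℕ; zero; suc; _∸_) renaming (_<_ to _<ℕ_)
open import Data.Product using (Σ; _×_; _,_)
open import Data.Sum using (_⊎_)
open import Relation.Binary.PropositionalEquality using (_≡_)
open import Relation.Nullary using (¬_)

data O : Set where
  𝟎    : O
  ω^_+_ : O → O → O

infixr 30 ω^_+_

data Cmp : Set where
  LT EQ GT : Cmp

cmp : O → O → Cmp
cmp 𝟎 𝟎 = EQ
cmp 𝟎 (ω^ _ + _) = LT
cmp (ω^ _ + _) 𝟎 = GT
cmp (ω^ a + b) (ω^ c + d) with cmp a c
... | LT = LT
... | GT = GT
... | EQ = cmp b d

_<ₒ_ : O → O → Set
a <ₒ b = cmp a b ≡ LT

_≤ₒ_ : O → O → Set
a ≤ₒ b = ¬ (cmp a b ≡ GT)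

data TailOK (a : O) : O → Set where
  tail0 : TailOK a 𝟎
  tailω : ∀ {c d} → c ≤ₒ a → TailOK a (ω^ c + d)

-- Cantor normal form: exactly the ordinals < ε₀
data CNF : O → Set where
  cnf0 : CNF 𝟎
  cnfω : ∀ {a b} → CNF a → CNF b → TailOK a b → CNF (ω^ a + b)

infixl 6 _⊕_
_⊕_ : O → O → O
𝟎 ⊕ b = b
(ω^ a + c) ⊕ 𝟎 = ω^ a + c
(ω^ a + c) ⊕ (ω^ d + e) with cmp a d
... | LT = ω^ d + e
... | EQ = ω^ a + (c ⊕ (ω^ d + e))
... | GT = ω^ a + (c ⊕ (ω^ d + e))

infixl 7 _⊗_
_⊗_ : O → O → O
𝟎 ⊗ β = 𝟎
(ω^ a + c) ⊗ 𝟎 = 𝟎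
(ω^ a + c) ⊗ (ω^ 𝟎 + e) = (ω^ a + c) ⊕ ((ω^ a + c) ⊗ e)
(ω^ a + c) ⊗ (ω^ (ω^ d₁ + d₂) + e) =
  (ω^ (a ⊕ (ω^ d₁ + d₂)) + 𝟎) ⊕ ((ω^ a + c) ⊗ e)

one two : O
one = ω^ 𝟎 + 𝟎
two = ω^ 𝟎 + one

-- e¹(α) = -1 + ω^α
e¹ : O → O
e¹ 𝟎 = 𝟎
e¹ (ω^ a + b) = ω^ (ω^ a + b) + 𝟎

e : ℕ → O → O
e zero α = α
e (suc n) α = e¹ (e n α)

infixr 5 _∧_
data F : Set where
  ⊤'    : F
  _∧_   : F → F → F
  ⟨_^_⟩_ : ℕ → O → F → F

◇ : ℕ → O → F → F
◇ n 𝟎 φ = φ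
◇ n (ω^ a + b) φ = ⟨ n ^ ω^ a + b ⟩ φ

-- membership in 𝔽_{ε₀} (modalities carry nonzero ordinals < ε₀;
-- ⟨n^0⟩φ is not a separate formula but an abbreviation for φ)
data WF : F → Set where
  wf⊤ : WF ⊤'
  wf∧ : ∀ {φ ψ} → WF φ → WF ψ → WF (φ ∧ ψ)
  wf◇ : ∀ {n α φ} → CNF α → 𝟎 <ₒ α → WF φ → WF (⟨ n ^ α ⟩ φ)

data Head (n₀ : ℕ) (α₀ : O) : F → Set where
  hd-mono : Head n₀ α₀ (⟨ n₀ ^ α₀ ⟩ ⊤')
  hd-conj : ∀ χ → Head n₀ α₀ (⟨ n₀ ^ α₀ ⟩ ⊤' ∧ χ)

data MNF : F → Set where
  mnf⊤    : MNF ⊤'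
  mnfMono : ∀ n α → CNF α → 𝟎 <ₒ α → MNF (⟨ n ^ α ⟩ ⊤')
  mnfCons : ∀ {ψ} n n₀ α₀ β → MNF ψ → Head n₀ α₀ ψ → n <ℕ n₀ → CNF β →
            MNF (⟨ n ^ e (n₀ ∸ n) α₀ ⊗ (two ⊕ β) ⟩ ⊤' ∧ ψ)

infix 2 _⊢_
data _⊢_ : F → F → Set where
  ax-id   : ∀ {φ} → WF φ → φ ⊢ φ
  ax-top  : ∀ {φ} → WF φ → φ ⊢ ⊤'
  ax-∧l   : ∀ {φ ψ} → WF φ → WF ψ → φ ∧ ψ ⊢ φ
  ax-∧r   : ∀ {φ ψ} → WF φ → WF ψ → φ ∧ ψ ⊢ ψ
  ax-mon  : ∀ {n α β φ} → CNF α → CNF β → WF φ → β ≤ₒ α →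
            ◇ n α φ ⊢ ◇ n β φ
  ax-add₁ : ∀ {n α β φ} → CNF α → CNF β → WF φ →
            ◇ n (α ⊕ β) φ ⊢ ◇ n β (◇ n α φ)
  ax-add₂ : ∀ {n α β φ} → CNF α → CNF β → WF φ →
            ◇ n β (◇ n α φ) ⊢ ◇ n (α ⊕ β) φ
  ax-red  : ∀ {m n α φ} → CNF α → WF φ →
            ◇ (m Data.Nat.+ n) α φ ⊢ ◇ m (e n α) φ
  ax-sch₁ : ∀ {n n₀ α₀ α ψ} → MNF ψ → Head n₀ α₀ ψ → n <ℕ n₀ → CNF α →
            ◇ n α ψ ⊢ ◇ n (e (n₀ ∸ n) α₀ ⊗ (one ⊕ α)) ⊤' ∧ ψ
  ax-sch₂ : ∀ {n n₀ α₀ α ψ} → MNF ψ → Head n₀ α₀ ψ → n <ℕ n₀ → CNF α →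
            ◇ n (e (n₀ ∸ n) α₀ ⊗ (one ⊕ α)) ⊤' ∧ ψ ⊢ ◇ n α ψ
  r-∧     : ∀ {φ ψ χ} → φ ⊢ ψ → φ ⊢ χ → φ ⊢ ψ ∧ χ
  r-cut   : ∀ {φ ψ χ} → φ ⊢ ψ → ψ ⊢ χ → φ ⊢ χ
  r-nec   : ∀ {n α φ ψ} → CNF α → φ ⊢ ψ → ◇ n α φ ⊢ ◇ n α ψ
  r-pull  : ∀ {n m α β φ ψ} → CNF α → CNF β → m <ℕ n → φ ⊢ ψ →
            ◇ n α φ ∧ ⟨ m ^ β ⊕ one ⟩ ψ ⊢ ◇ n α (φ ∧ ⟨ m ^ β ⊕ one ⟩ ψ)

-- Interpret a formula φ as a finite sequence ⟦φ⟧ = (o₀, o₁, …) of ordinals (zero beyond its end),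
-- one for each level n. The sequences that occur are normal: each entry is a nonzero multiple of
-- ω to the power of the next one, unless that next entry is 0. Conjunction is the least normal
-- upper bound, and ⟨n^α⟩ strictly raises oₙ (adjusting the lower entries to stay normal). Every
-- axiom and rule of TSC is sound for the reversed pointwise order: for the Schmerl axioms because
-- a modal normal form headed by ⟨n₀^α₀⟩ denotes a tower whose entries below level n₀ are
-- hyper-exponentials of α₀. Hence φ ⊢ ⟨n^α⟩φ would make oₙ(φ) smaller than itself.

module Submission where

open import Data.Nat using (ℕ; zero; suc; _+_; _∸_; z≤n; s≤s) renaming (_<_ to _<ℕ_; _≤_ to _≤ℕ_)
open import Data.Nat.Properties using (+-identityʳ; <⇒≤)
open import Data.Empty using (⊥-elim)
open import Data.Product using (∃; _×_; _,_; proj₁; proj₂)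
open import Data.Sum using (_⊎_; inj₁; inj₂)
open import Data.List using (List; []; _∷_)
open import Relation.Binary.Definitions using (Tri; tri<; tri≈; tri>; Trichotomous; Decidable)
open import Relation.Binary.PropositionalEquality
open import Relation.Nullary using (¬_; Dec; yes; no)
open import Defs

infix 4 _<_ _≤_

data _<_ : O → O → Set where
  𝟎<ω^  : ∀ {a b} → 𝟎 < ω^ a + b
  exp<  : ∀ {a b c d} → a < c → ω^ a + b < ω^ c + d
  tail< : ∀ {a b d} → b < d → ω^ a + b < ω^ a + d

_≤_ : O → O → Set
a ≤ b = a < b ⊎ a ≡ b

<-irrefl : ∀ {a} → ¬ a < a
<-irrefl (exp< p) = <-irrefl p
<-irrefl (tail< p) = <-irrefl p

<-trans : ∀ {a b c} → a < b → b < c → a < c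
<-trans 𝟎<ω^ (exp< _) = 𝟎<ω^
<-trans 𝟎<ω^ (tail< _) = 𝟎<ω^
<-trans (exp< p) (exp< q) = exp< (<-trans p q)
<-trans (exp< p) (tail< _) = exp< p
<-trans (tail< _) (exp< q) = exp< q
<-trans (tail< p) (tail< q) = tail< (<-trans p q)

<-asym : ∀ {a b} → a < b → ¬ b < a
<-asym p q = <-irrefl (<-trans p q)

tri-< : ∀ {a b} → a < b → Tri (a < b) (a ≡ b) (b < a)
tri-< p = tri< p (λ { refl → <-irrefl p }) (<-asym p)

tri-> : ∀ {a b} → b < a → Tri (a < b) (a ≡ b) (b < a)
tri-> p = tri> (<-asym p) (λ { refl → <-irrefl p }) p

compare : Trichotomous _≡_ _<_
compare 𝟎 𝟎 = tri≈ (λ ()) refl (λ ())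
compare 𝟎 (ω^ _ + _) = tri< 𝟎<ω^ (λ ()) (λ ())
compare (ω^ _ + _) 𝟎 = tri> (λ ()) (λ ()) 𝟎<ω^
compare (ω^ a + b) (ω^ c + d) with compare a c
... | tri< a<c _ _ = tri-< (exp< a<c)
... | tri> _ _ c<a = tri-> (exp< c<a)
... | tri≈ _ refl _ with compare b d
...   | tri< b<d _ _ = tri-< (tail< b<d)
...   | tri≈ _ refl _ = tri≈ <-irrefl refl <-irrefl
...   | tri> _ _ d<b = tri-> (tail< d<b)

_<?_ : Decidable _<_
a <? b with compare a b
... | tri< p _ _ = yes p
... | tri≈ ¬p _ _ = no ¬p
... | tri> ¬p _ _ = no ¬p

≤-refl : ∀ {a} → a ≤ a
≤-refl = inj₂ refl

≤-trans : ∀ {a b c} → a ≤ b → b ≤ c → a ≤ c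
≤-trans (inj₁ p) (inj₁ q) = inj₁ (<-trans p q)
≤-trans (inj₁ p) (inj₂ refl) = inj₁ p
≤-trans (inj₂ refl) q = q

<-≤-trans : ∀ {a b c} → a < b → b ≤ c → a < c
<-≤-trans p (inj₁ q) = <-trans p q
<-≤-trans p (inj₂ refl) = p

≤-<-trans : ∀ {a b c} → a ≤ b → b < c → a < c
≤-<-trans (inj₁ p) q = <-trans p q
≤-<-trans (inj₂ refl) q = q

≤⇒≯ : ∀ {a b} → a ≤ b → ¬ b < a
≤⇒≯ (inj₁ p) = <-asym p
≤⇒≯ (inj₂ refl) = <-irrefl

≮⇒≥ : ∀ {a b} → ¬ a < b → b ≤ a
≮⇒≥ {a} {b} a≮b with compare a b
... | tri< p _ _ = ⊥-elim (a≮b p)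
... | tri≈ _ a≡b _ = inj₂ (sym a≡b)
... | tri> _ _ b<a = inj₁ b<a

𝟎≤ : ∀ {a} → 𝟎 ≤ a
𝟎≤ {𝟎} = ≤-refl
𝟎≤ {ω^ _ + _} = inj₁ 𝟎<ω^

cmp-refl : ∀ a → cmp a a ≡ EQ
cmp-refl 𝟎 = refl
cmp-refl (ω^ a + b) rewrite cmp-refl a = cmp-refl b

<⇒cmp≡LT : ∀ {a b} → a < b → cmp a b ≡ LT
<⇒cmp≡LT 𝟎<ω^ = refl
<⇒cmp≡LT (exp< p) rewrite <⇒cmp≡LT p = refl
<⇒cmp≡LT {ω^ a + _} (tail< p) rewrite cmp-refl a = <⇒cmp≡LT p

<⇒cmp≡GT : ∀ {a b} → a < b → cmp b a ≡ GT
<⇒cmp≡GT 𝟎<ω^ = refl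
<⇒cmp≡GT (exp< p) rewrite <⇒cmp≡GT p = refl
<⇒cmp≡GT {ω^ a + _} (tail< p) rewrite cmp-refl a = <⇒cmp≡GT p

cmp≡LT⇒< : ∀ {a b} → cmp a b ≡ LT → a < b
cmp≡LT⇒< {a} {b} eq with compare a b
... | tri< a<b _ _ = a<b
... | tri≈ _ refl _ with () ← trans (sym eq) (cmp-refl a)
... | tri> _ _ b<a with () ← trans (sym eq) (<⇒cmp≡GT b<a)

≤ₒ⇒≤ : ∀ {a b} → a ≤ₒ b → a ≤ b
≤ₒ⇒≤ {a} {b} a≤ₒb with compare a b
... | tri< a<b _ _ = inj₁ a<b
... | tri≈ _ a≡b _ = inj₂ a≡b
... | tri> _ _ b<a = ⊥-elim (a≤ₒb (<⇒cmp≡GT b<a))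

≤⇒≤ₒ : ∀ {a b} → a ≤ b → a ≤ₒ b
≤⇒≤ₒ (inj₁ a<b) cmp≡GT with () ← trans (sym (<⇒cmp≡LT a<b)) cmp≡GT
≤⇒≤ₒ {a} (inj₂ refl) cmp≡GT with () ← trans (sym (cmp-refl a)) cmp≡GT

data Positive : O → Set where
  positive : ∀ {a b} → Positive (ω^ a + b)

<⇒positive : ∀ {a b} → a < b → Positive b
<⇒positive 𝟎<ω^ = positive
<⇒positive (exp< _) = positive
<⇒positive (tail< _) = positive

>ₒ𝟎⇒positive : ∀ {a} → 𝟎 <ₒ a → Positive a
>ₒ𝟎⇒positive {ω^ _ + _} _ = positive

⊕-identityʳ : ∀ a → a ⊕ 𝟎 ≡ a
⊕-identityʳ 𝟎 = refl
⊕-identityʳ (ω^ _ + _) = refl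

⊕-lead< : ∀ {a c d e} → a < d → (ω^ a + c) ⊕ (ω^ d + e) ≡ ω^ d + e
⊕-lead< {a} {d = d} a<d with cmp a d in eq
... | LT = refl
... | EQ with () ← trans (sym eq) (<⇒cmp≡LT a<d)
... | GT with () ← trans (sym eq) (<⇒cmp≡LT a<d)

⊕-lead≮ : ∀ {a c d e} → ¬ a < d → (ω^ a + c) ⊕ (ω^ d + e) ≡ ω^ a + (c ⊕ (ω^ d + e))
⊕-lead≮ {a} {d = d} a≮d with cmp a d in eq
... | EQ = refl
... | GT = refl
... | LT = ⊥-elim (a≮d (cmp≡LT⇒< eq))

⊕-assoc : ∀ x y z → (x ⊕ y) ⊕ z ≡ x ⊕ (y ⊕ z)
⊕-assoc 𝟎 y z = refl
⊕-assoc (ω^ a + c) 𝟎 z = refl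
⊕-assoc x@(ω^ _ + _) y@(ω^ _ + _) 𝟎 rewrite ⊕-identityʳ (x ⊕ y) | ⊕-identityʳ y = refl
⊕-assoc (ω^ a + c) (ω^ d + e) (ω^ f + g) with a <? d | d <? f | a <? f
... | yes a<d | yes d<f | _
  rewrite ⊕-lead< {a} {c} {d} {e} a<d | ⊕-lead< {d} {e} {f} {g} d<f
        | ⊕-lead< {a} {c} {f} {g} (<-trans a<d d<f) = refl
... | yes a<d | no d≮f | _
  rewrite ⊕-lead< {a} {c} {d} {e} a<d | ⊕-lead≮ {d} {e} {f} {g} d≮f
        | ⊕-lead< {a} {c} {d} {e ⊕ (ω^ f + g)} a<d = refl
... | no a≮d | _ | yes a<f
  rewrite ⊕-lead≮ {a} {c} {d} {e} a≮d | ⊕-lead< {a} {c ⊕ (ω^ d + e)} {f} {g} a<f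
        | ⊕-lead< {d} {e} {f} {g} (≤-<-trans (≮⇒≥ a≮d) a<f) | ⊕-lead< {a} {c} {f} {g} a<f = refl
... | no a≮d | yes d<f | no a≮f
  rewrite ⊕-lead≮ {a} {c} {d} {e} a≮d | ⊕-lead≮ {a} {c ⊕ (ω^ d + e)} {f} {g} a≮f
        | ⊕-assoc c (ω^ d + e) (ω^ f + g)
        | ⊕-lead< {d} {e} {f} {g} d<f | ⊕-lead≮ {a} {c} {f} {g} a≮f = refl
... | no a≮d | no d≮f | no a≮f
  rewrite ⊕-lead≮ {a} {c} {d} {e} a≮d | ⊕-lead≮ {a} {c ⊕ (ω^ d + e)} {f} {g} a≮f
        | ⊕-assoc c (ω^ d + e) (ω^ f + g)
        | ⊕-lead≮ {d} {e} {f} {g} d≮f | ⊕-lead≮ {a} {c} {d} {e ⊕ (ω^ f + g)} a≮d = refl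

positive-⊕ˡ : ∀ {a} b → Positive a → Positive (a ⊕ b)
positive-⊕ˡ 𝟎 positive = positive
positive-⊕ˡ {ω^ a + c} (ω^ d + e) positive with a <? d
... | yes a<d rewrite ⊕-lead< {a} {c} {d} {e} a<d = positive
... | no a≮d rewrite ⊕-lead≮ {a} {c} {d} {e} a≮d = positive

positive-⊕ʳ : ∀ a {b} → Positive b → Positive (a ⊕ b)
positive-⊕ʳ 𝟎 p = p
positive-⊕ʳ (ω^ _ + _) {b} positive = positive-⊕ˡ b positive

a<a⊕b : ∀ a {b} → Positive b → a < a ⊕ b
a<a⊕b 𝟎 positive = 𝟎<ω^
a<a⊕b (ω^ a + c) {ω^ d + e} positive with a <? d
... | yes a<d rewrite ⊕-lead< {a} {c} {d} {e} a<d = exp< a<d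
... | no a≮d rewrite ⊕-lead≮ {a} {c} {d} {e} a≮d = tail< (a<a⊕b c positive)

a≤a⊕b : ∀ a b → a ≤ a ⊕ b
a≤a⊕b a 𝟎 rewrite ⊕-identityʳ a = ≤-refl
a≤a⊕b a (ω^ _ + _) = inj₁ (a<a⊕b a positive)

tail<ω^+ : ∀ {a b} → CNF (ω^ a + b) → b < ω^ a + b
tail<ω^+ (cnfω _ _ tail0) = 𝟎<ω^
tail<ω^+ (cnfω _ cb (tailω c≤a)) with ≤ₒ⇒≤ c≤a
... | inj₁ c<a = exp< c<a
... | inj₂ refl = tail< (tail<ω^+ cb)

b≤a⊕b : ∀ a {b} → CNF b → b ≤ a ⊕ b
b≤a⊕b 𝟎 cb = ≤-refl
b≤a⊕b (ω^ _ + _) {𝟎} cb = 𝟎≤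
b≤a⊕b (ω^ a + c) {ω^ d + e} cb with a <? d
... | yes a<d rewrite ⊕-lead< {a} {c} {d} {e} a<d = ≤-refl
... | no a≮d rewrite ⊕-lead≮ {a} {c} {d} {e} a≮d with ≮⇒≥ a≮d
...   | inj₁ d<a = inj₁ (exp< d<a)
...   | inj₂ refl = inj₁ (tail< (<-≤-trans (tail<ω^+ cb) (b≤a⊕b c cb)))

tailOK-⊕ : ∀ {a c d e} → TailOK a c → ¬ a < d → TailOK a (c ⊕ (ω^ d + e))
tailOK-⊕ tail0 a≮d = tailω (≤⇒≤ₒ (≮⇒≥ a≮d))
tailOK-⊕ {c = ω^ c₁ + c₂} {d} {e} (tailω c₁≤a) a≮d with c₁ <? d
... | yes c₁<d rewrite ⊕-lead< {c₁} {c₂} {d} {e} c₁<d = tailω (≤⇒≤ₒ (≮⇒≥ a≮d))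
... | no c₁≮d rewrite ⊕-lead≮ {c₁} {c₂} {d} {e} c₁≮d = tailω c₁≤a

cnf-⊕ : ∀ {a b} → CNF a → CNF b → CNF (a ⊕ b)
cnf-⊕ cnf0 cb = cb
cnf-⊕ ca@(cnfω _ _ _) cnf0 = ca
cnf-⊕ {ω^ a + c} {ω^ d + e} (cnfω ca cc tc) cb with a <? d
... | yes a<d rewrite ⊕-lead< {a} {c} {d} {e} a<d = cb
... | no a≮d rewrite ⊕-lead≮ {a} {c} {d} {e} a≮d = cnfω ca (cnf-⊕ cc cb) (tailOK-⊕ tc a≮d)

tailOK⇒< : ∀ {a b c d} → TailOK a b → a < c → b < ω^ c + d
tailOK⇒< tail0 _ = 𝟎<ω^
tailOK⇒< (tailω b≤a) a<c = exp< (≤-<-trans (≤ₒ⇒≤ b≤a) a<c)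

≤⇒∃⊕ : ∀ {a b} → CNF a → CNF b → a ≤ b → ∃ λ δ → CNF δ × b ≡ a ⊕ δ
≤⇒∃⊕ {𝟎} {b} _ cb _ = b , cb , refl
≤⇒∃⊕ {ω^ _ + _} _ _ (inj₂ refl) = 𝟎 , cnf0 , refl
≤⇒∃⊕ {ω^ a + c} {ω^ d + e} _ cb (inj₁ (exp< a<d)) = ω^ d + e , cb , sym (⊕-lead< {a} {c} {d} {e} a<d)
≤⇒∃⊕ {ω^ a + c} {ω^ .a + e} (cnfω _ cc _) (cnfω _ ce te) (inj₁ (tail< c<e))
  with ≤⇒∃⊕ cc ce (inj₁ c<e)
... | 𝟎 , _ , e≡c⊕𝟎 rewrite ⊕-identityʳ c = 𝟎 , cnf0 , cong (ω^ a +_) e≡c⊕𝟎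
... | δ@(ω^ h + k) , cδ , e≡c⊕δ = δ , cδ , trans (cong (ω^ a +_) e≡c⊕δ) (sym (⊕-lead≮ a≮h))
  where
  -- δ is a summand of the tail e, so its leading exponent is at most a
  a≮h : ¬ a < h
  a≮h a<h = ≤⇒≯ (subst (δ ≤_) (sym e≡c⊕δ) (b≤a⊕b c cδ)) (tailOK⇒< te a<h)

⊕-monoʳ-≤ : ∀ a {b c} → CNF b → CNF c → b ≤ c → a ⊕ b ≤ a ⊕ c
⊕-monoʳ-≤ a {b} cb cc b≤c with ≤⇒∃⊕ cb cc b≤c
... | δ , _ , refl rewrite sym (⊕-assoc a b δ) = a≤a⊕b (a ⊕ b) δ

⊕-monoˡ-≤ : ∀ {a b} c → CNF a → CNF b → CNF c → a ≤ b → a ⊕ c ≤ b ⊕ c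
⊕-monoˡ-≤ {a} c ca cb cc a≤b with ≤⇒∃⊕ ca cb a≤b
... | δ , cδ , refl rewrite ⊕-assoc a δ c = ⊕-monoʳ-≤ a cc (cnf-⊕ cδ cc) (b≤a⊕b δ cc)

⊕-monoʳ-< : ∀ a {b c} → CNF b → CNF c → b < c → a ⊕ b < a ⊕ c
⊕-monoʳ-< a {b} cb cc b<c with ≤⇒∃⊕ cb cc (inj₁ b<c)
... | 𝟎 , _ , c≡b⊕𝟎 rewrite ⊕-identityʳ b = ⊥-elim (<-irrefl (subst (b <_) c≡b⊕𝟎 b<c))
... | ω^ h + k , _ , refl rewrite sym (⊕-assoc a b (ω^ h + k)) = a<a⊕b (a ⊕ b) positive

ω^⟨_⟩ : O → O
ω^⟨ a ⟩ = ω^ a + 𝟎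

cnf-ω^ : ∀ {a} → CNF a → CNF ω^⟨ a ⟩
cnf-ω^ ca = cnfω ca cnf0 tail0

cnf-one : CNF one
cnf-one = cnfω cnf0 cnf0 tail0

ω^-mono-≤ : ∀ {a b} → a ≤ b → ω^⟨ a ⟩ ≤ ω^⟨ b ⟩
ω^-mono-≤ (inj₁ a<b) = inj₁ (exp< a<b)
ω^-mono-≤ (inj₂ refl) = ≤-refl

ω^⊗ω^+ : ∀ c d e → ω^⟨ c ⟩ ⊗ (ω^ d + e) ≡ ω^⟨ c ⊕ d ⟩ ⊕ (ω^⟨ c ⟩ ⊗ e)
ω^⊗ω^+ c 𝟎 e rewrite ⊕-identityʳ c = refl
ω^⊗ω^+ c (ω^ _ + _) e = refl

ω^⊗ω^ : ∀ a b → ω^⟨ a ⟩ ⊗ ω^⟨ b ⟩ ≡ ω^⟨ a ⊕ b ⟩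
ω^⊗ω^ a b rewrite ω^⊗ω^+ a b 𝟎 = refl

ω^⊗-identityʳ : ∀ c → ω^⟨ c ⟩ ⊗ one ≡ ω^⟨ c ⟩
ω^⊗-identityʳ c rewrite ω^⊗ω^ c 𝟎 | ⊕-identityʳ c = refl

cnf-ω^⊗ : ∀ {c β} → CNF c → CNF β → CNF (ω^⟨ c ⟩ ⊗ β)
cnf-ω^⊗ cc cnf0 = cnf0
cnf-ω^⊗ {c} {ω^ d + e} cc (cnfω cd ce _) rewrite ω^⊗ω^+ c d e =
  cnf-⊕ (cnf-ω^ (cnf-⊕ cc cd)) (cnf-ω^⊗ cc ce)

positive-ω^⊗ : ∀ c {β} → Positive β → Positive (ω^⟨ c ⟩ ⊗ β)
positive-ω^⊗ c {ω^ d + e} positive rewrite ω^⊗ω^+ c d e = positive-⊕ˡ (ω^⟨ c ⟩ ⊗ e) positive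

tailOK-absorb : ∀ {a b c d} → TailOK a b → a < c → b ⊕ (ω^ c + d) ≡ ω^ c + d
tailOK-absorb tail0 _ = refl
tailOK-absorb {b = ω^ b₁ + b₂} {c} {d} (tailω b₁≤a) a<c = ⊕-lead< {b₁} {b₂} {c} {d} (≤-<-trans (≤ₒ⇒≤ b₁≤a) a<c)

ω^⊗-distribˡ-⊕ : ∀ c {α} β → CNF c → CNF α → CNF β → ω^⟨ c ⟩ ⊗ (α ⊕ β) ≡ ω^⟨ c ⟩ ⊗ α ⊕ ω^⟨ c ⟩ ⊗ β
ω^⊗-distribˡ-⊕ c {𝟎} β _ _ _ = refl
ω^⊗-distribˡ-⊕ c {ω^ _ + _} 𝟎 _ _ _ = sym (⊕-identityʳ _)
ω^⊗-distribˡ-⊕ c {ω^ d + e} (ω^ f + g) cc (cnfω cd ce te) cβ@(cnfω cf _ _) with d <? f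
... | yes d<f rewrite ⊕-lead< {d} {e} {f} {g} d<f | ω^⊗ω^+ c d e
   | ⊕-assoc ω^⟨ c ⊕ d ⟩ (ω^⟨ c ⟩ ⊗ e) (ω^⟨ c ⟩ ⊗ (ω^ f + g))
   | sym (ω^⊗-distribˡ-⊕ c (ω^ f + g) cc ce cβ) | tailOK-absorb {d} {e} {f} {g} te d<f
   | ω^⊗ω^+ c f g | sym (⊕-assoc ω^⟨ c ⊕ d ⟩ ω^⟨ c ⊕ f ⟩ (ω^⟨ c ⟩ ⊗ g))
   | ⊕-lead< {c ⊕ d} {𝟎} {c ⊕ f} {𝟎} (⊕-monoʳ-< c cd cf d<f) = refl
... | no d≮f rewrite ⊕-lead≮ {d} {e} {f} {g} d≮f | ω^⊗ω^+ c d (e ⊕ (ω^ f + g)) | ω^⊗ω^+ c d e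
   | ω^⊗-distribˡ-⊕ c (ω^ f + g) cc ce cβ = sym (⊕-assoc ω^⟨ c ⊕ d ⟩ (ω^⟨ c ⟩ ⊗ e) (ω^⟨ c ⟩ ⊗ (ω^ f + g)))

one⊗ : ∀ {γ} → CNF γ → one ⊗ γ ≡ γ
one⊗ cnf0 = refl
one⊗ {ω^ d + e} (cnfω _ ce te) rewrite ω^⊗ω^+ 𝟎 d e | one⊗ ce = ω^⊕tail te
  where
  ω^⊕tail : TailOK d e → ω^⟨ d ⟩ ⊕ e ≡ ω^ d + e
  ω^⊕tail tail0 = refl
  ω^⊕tail (tailω {f} {h} f≤d) = ⊕-lead≮ {d} {𝟎} {f} {h} (≤⇒≯ (≤ₒ⇒≤ f≤d))

ω^⊗-monoʳ-≤ : ∀ c {β γ} → CNF c → CNF β → CNF γ → β ≤ γ → ω^⟨ c ⟩ ⊗ β ≤ ω^⟨ c ⟩ ⊗ γ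
ω^⊗-monoʳ-≤ c {β} cc cβ cγ β≤γ with ≤⇒∃⊕ cβ cγ β≤γ
... | δ , cδ , refl rewrite ω^⊗-distribˡ-⊕ c δ cc cβ cδ = a≤a⊕b _ _

ω^⊗-monoˡ-≤ : ∀ {a b} γ → CNF a → CNF b → CNF γ → a ≤ b → ω^⟨ a ⟩ ⊗ γ ≤ ω^⟨ b ⟩ ⊗ γ
ω^⊗-monoˡ-≤ 𝟎 _ _ _ _ = ≤-refl
ω^⊗-monoˡ-≤ {a} {b} (ω^ d + e) ca cb (cnfω cd ce _) a≤b rewrite ω^⊗ω^+ a d e | ω^⊗ω^+ b d e =
  ≤-trans (⊕-monoˡ-≤ (ω^⟨ a ⟩ ⊗ e) (cnf-ω^ (cnf-⊕ ca cd)) (cnf-ω^ (cnf-⊕ cb cd)) (cnf-ω^⊗ ca ce)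
             (ω^-mono-≤ (⊕-monoˡ-≤ d ca cb cd a≤b)))
          (⊕-monoʳ-≤ ω^⟨ b ⊕ d ⟩ (cnf-ω^⊗ ca ce) (cnf-ω^⊗ cb ce) (ω^⊗-monoˡ-≤ e ca cb ce a≤b))

γ≤ω^⊗γ : ∀ {c γ} → CNF c → CNF γ → γ ≤ ω^⟨ c ⟩ ⊗ γ
γ≤ω^⊗γ {c} {γ} cc cγ = subst (_≤ ω^⟨ c ⟩ ⊗ γ) (one⊗ cγ) (ω^⊗-monoˡ-≤ γ cnf0 cc cγ 𝟎≤)

-- For t in Cantor normal form, Exps≥ a t says that ω^a divides t on the left.
data Exps≥ (a : O) : O → Set where
  exps𝟎  : Exps≥ a 𝟎
  expsω^ : ∀ {c d} → ¬ c < a → Exps≥ a d → Exps≥ a (ω^ c + d)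

exps≥-⊕ : ∀ {a} x {y} → Exps≥ a x → Exps≥ a y → Exps≥ a (x ⊕ y)
exps≥-⊕ 𝟎 _ ey = ey
exps≥-⊕ (ω^ _ + _) {𝟎} ex _ = ex
exps≥-⊕ (ω^ c + d) {ω^ f + g} (expsω^ c≮a ed) ey with c <? f
... | yes c<f rewrite ⊕-lead< {c} {d} {f} {g} c<f = ey
... | no c≮f rewrite ⊕-lead≮ {c} {d} {f} {g} c≮f = expsω^ c≮a (exps≥-⊕ d ed ey)

exps≥-⊕ω^ : ∀ {a} t → Exps≥ a (t ⊕ ω^⟨ a ⟩)
exps≥-⊕ω^ 𝟎 = expsω^ <-irrefl exps𝟎
exps≥-⊕ω^ {a} (ω^ c + d) with c <? a
... | yes c<a rewrite ⊕-lead< {c} {d} {a} {𝟎} c<a = expsω^ <-irrefl exps𝟎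
... | no c≮a rewrite ⊕-lead≮ {c} {d} {a} {𝟎} c≮a = expsω^ c≮a (exps≥-⊕ω^ d)

exps≥-antitone : ∀ {a b t} → b ≤ a → Exps≥ a t → Exps≥ b t
exps≥-antitone _ exps𝟎 = exps𝟎
exps≥-antitone b≤a (expsω^ c≮a ed) = expsω^ (λ c<b → c≮a (<-≤-trans c<b b≤a)) (exps≥-antitone b≤a ed)

exps≥-ω^⊗ : ∀ {c} β → CNF c → Exps≥ c (ω^⟨ c ⟩ ⊗ β)
exps≥-ω^⊗ 𝟎 _ = exps𝟎
exps≥-ω^⊗ {c} (ω^ d + e) cc rewrite ω^⊗ω^+ c d e =
  exps≥-⊕ ω^⟨ c ⊕ d ⟩ (expsω^ (≤⇒≯ (a≤a⊕b c d)) exps𝟎) (exps≥-ω^⊗ e cc)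

ω^≤ : ∀ {a z} → Exps≥ a z → Positive z → ω^⟨ a ⟩ ≤ z
ω^≤ {a} (expsω^ {c} {d} c≮a _) positive with ≮⇒≥ c≮a | d
... | inj₁ a<c | _ = inj₁ (exp< a<c)
... | inj₂ refl | 𝟎 = ≤-refl
... | inj₂ refl | ω^ _ + _ = inj₁ (tail< 𝟎<ω^)

⊕ω^-least : ∀ {a t z} → t < z → Exps≥ a z → t ⊕ ω^⟨ a ⟩ ≤ z
⊕ω^-least {t = 𝟎} t<z ez = ω^≤ ez (<⇒positive t<z)
⊕ω^-least {a} {ω^ c + d} (exp< c<c′) ez with c <? a
... | yes c<a rewrite ⊕-lead< {c} {d} {a} {𝟎} c<a = ω^≤ ez positive
... | no c≮a rewrite ⊕-lead≮ {c} {d} {a} {𝟎} c≮a = inj₁ (exp< c<c′)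
⊕ω^-least {a} {ω^ c + d} (tail< d<d′) (expsω^ c≮a ed)
  rewrite ⊕-lead≮ {c} {d} {a} {𝟎} c≮a with ⊕ω^-least d<d′ ed
... | inj₁ p = inj₁ (tail< p)
... | inj₂ p = inj₂ (cong (ω^ c +_) p)

exps≥? : ∀ a t → Dec (Exps≥ a t)
exps≥? a 𝟎 = yes exps𝟎
exps≥? a (ω^ c + d) with c <? a | exps≥? a d
... | yes c<a | _ = no λ { (expsω^ c≮a _) → c≮a c<a }
... | no c≮a | yes ed = yes (expsω^ c≮a ed)
... | no _ | no ¬ed = no λ { (expsω^ _ ed) → ¬ed ed }

Normal : O → O → Set
Normal a t = a ≡ 𝟎 ⊎ Positive t × Exps≥ a t

normal? : ∀ a t → Dec (Normal a t)
normal? 𝟎 t = yes (inj₁ refl)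
normal? (ω^ _ + _) 𝟎 = no λ { (inj₁ ()) ; (inj₂ (() , _)) }
normal? a@(ω^ _ + _) t@(ω^ _ + _) with exps≥? a t
... | yes e = yes (inj₂ (positive , e))
... | no ¬e = no λ { (inj₁ ()) ; (inj₂ (_ , e)) → ¬e e }

normal-antitone : ∀ {a b t} → b ≤ a → Normal a t → Normal b t
normal-antitone (inj₁ ()) (inj₁ refl)
normal-antitone (inj₂ refl) (inj₁ refl) = inj₁ refl
normal-antitone b≤a (inj₂ (p , e)) = inj₂ (p , exps≥-antitone b≤a e)

normal⇒exps≥ : ∀ {a b z} → Normal a z → Positive b → b ≤ a → Exps≥ b z
normal⇒exps≥ (inj₁ refl) () (inj₂ refl)
normal⇒exps≥ (inj₂ (_ , e)) _ b≤a = exps≥-antitone b≤a e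

normalize : O → O → O
normalize a t with normal? a t
... | yes _ = t
... | no _ = t ⊕ ω^⟨ a ⟩

normalize-id : ∀ {a t} → Normal a t → normalize a t ≡ t
normalize-id {a} {t} n with normal? a t
... | yes _ = refl
... | no ¬n = ⊥-elim (¬n n)

cnf-normalize : ∀ {a t} → CNF a → CNF t → CNF (normalize a t)
cnf-normalize {a} {t} ca ct with normal? a t
... | yes _ = ct
... | no _ = cnf-⊕ ct (cnf-ω^ ca)

normal-normalize : ∀ a t → Normal a (normalize a t)
normal-normalize a t with normal? a t
... | yes n = n
... | no _ = inj₂ (positive-⊕ʳ t positive , exps≥-⊕ω^ t)

≤-normalize : ∀ a t → t ≤ normalize a t
≤-normalize a t with normal? a t
... | yes _ = ≤-refl
... | no _ = a≤a⊕b t ω^⟨ a ⟩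

normalize-least : ∀ {a t z} → t ≤ z → Normal a z → normalize a t ≤ z
normalize-least {a} {t} t≤z nz with normal? a t | nz | t≤z
... | yes _ | _ | _ = t≤z
... | no ¬nt | inj₁ refl | _ = ⊥-elim (¬nt (inj₁ refl))
... | no ¬nt | inj₂ _ | inj₂ refl = ⊥-elim (¬nt nz)
... | no _ | inj₂ (_ , ez) | inj₁ t<z = ⊕ω^-least t<z ez

normalize⊕ω^ : ∀ {a b} t → a < b → normalize a t ⊕ ω^⟨ b ⟩ ≡ t ⊕ ω^⟨ b ⟩
normalize⊕ω^ {a} {b} t a<b with normal? a t
... | yes _ = refl
... | no _ rewrite ⊕-assoc t ω^⟨ a ⟩ ω^⟨ b ⟩ | ⊕-lead< {a} {𝟎} {b} {𝟎} a<b = refl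

max : O → O → O
max a b with b <? a
... | yes _ = a
... | no _ = b

≤-maxˡ : ∀ a b → a ≤ max a b
≤-maxˡ a b with b <? a
... | yes _ = ≤-refl
... | no b≮a = ≮⇒≥ b≮a

≤-maxʳ : ∀ a b → b ≤ max a b
≤-maxʳ a b with b <? a
... | yes b<a = inj₁ b<a
... | no _ = ≤-refl

max-elim : ∀ (P : O → Set) {a b} → P a → P b → P (max a b)
max-elim P {a} {b} pa pb with b <? a
... | yes _ = pa
... | no _ = pb

max-≤ : ∀ {a b} → b ≤ a → max a b ≡ a
max-≤ {a} {b} b≤a with b <? a
... | yes _ = refl
... | no b≮a with b≤a
...   | inj₁ b<a = ⊥-elim (b≮a b<a)
...   | inj₂ refl = refl

max-𝟎 : ∀ b → max 𝟎 b ≡ b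
max-𝟎 b with b <? 𝟎
... | no _ = refl

-- Sequences of ordinals, padded with zeros

head : List O → O
head [] = 𝟎
head (a ∷ _) = a

tail : List O → List O
tail [] = []
tail (_ ∷ v) = v

at : List O → ℕ → O
at v zero = head v
at v (suc k) = at (tail v) k

at-[] : ∀ k → at [] k ≡ 𝟎
at-[] zero = refl
at-[] (suc k) = at-[] k

infix 4 _⊑_

_⊑_ : List O → List O → Set
v ⊑ w = ∀ k → at v k ≤ at w k

⊑-intro : ∀ {v w} → head v ≤ head w → tail v ⊑ tail w → v ⊑ w
⊑-intro h _ zero = h
⊑-intro _ t (suc k) = t k

⊑-head : ∀ {v w} → v ⊑ w → head v ≤ head w
⊑-head p = p zero

⊑-tail : ∀ {v w} → v ⊑ w → tail v ⊑ tail w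
⊑-tail p k = p (suc k)

⊑-refl : ∀ {v} → v ⊑ v
⊑-refl _ = ≤-refl

⊑-reflexive : ∀ {v w} → v ≡ w → v ⊑ w
⊑-reflexive refl = ⊑-refl

⊑-trans : ∀ {u v w} → u ⊑ v → v ⊑ w → u ⊑ w
⊑-trans p q k = ≤-trans (p k) (q k)

[]⊑ : ∀ {v} → [] ⊑ v
[]⊑ k rewrite at-[] k = 𝟎≤

record NormalSeq (v : List O) : Set where
  field
    cnf    : ∀ k → CNF (at v k)
    normal : ∀ k → Normal (at v (suc k)) (at v k)

open NormalSeq

normalSeq-tail : ∀ {v} → NormalSeq v → NormalSeq (tail v)
normalSeq-tail nv = record { cnf = λ k → cnf nv (suc k) ; normal = λ k → normal nv (suc k) }

normalSeq-intro : ∀ {v} → CNF (head v) → Normal (head (tail v)) (head v) → NormalSeq (tail v) → NormalSeq v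
normalSeq-intro ch nh nt = record
  { cnf    = λ { zero → ch ; (suc k) → cnf nt k }
  ; normal = λ { zero → nh ; (suc k) → normal nt k } }

cnf-head : ∀ {v} → NormalSeq v → CNF (head v)
cnf-head nv = cnf nv zero

normal-head : ∀ {v} → NormalSeq v → Normal (head (tail v)) (head v)
normal-head nv = normal nv zero

normalSeq-[] : NormalSeq []
normalSeq-[] = record
  { cnf    = λ k → subst CNF (sym (at-[] k)) cnf0
  ; normal = λ k → inj₁ (at-[] (suc k)) }

-- Join: the least normal sequence above two normal sequences

cons-normalized : O → List O → List O
cons-normalized t u = normalize (head u) t ∷ u

infixr 6 _⊔_

_⊔_ : List O → List O → List O
[] ⊔ [] = []
(a ∷ v) ⊔ (b ∷ w) = cons-normalized (max a b) (v ⊔ w)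
(a ∷ v) ⊔ [] = cons-normalized (max a 𝟎) (v ⊔ [])
[] ⊔ (b ∷ w) = cons-normalized (max 𝟎 b) ([] ⊔ w)

⊔-ind : (P : List O → List O → Set) → P [] [] → (∀ v w → P (tail v) (tail w) → P v w) → ∀ v w → P v w
⊔-ind P base step [] [] = base
⊔-ind P base step v@(_ ∷ v′) w@(_ ∷ w′) = step v w (⊔-ind P base step v′ w′)
⊔-ind P base step v@(_ ∷ v′) [] = step v [] (⊔-ind P base step v′ [])
⊔-ind P base step [] w@(_ ∷ w′) = step [] w (⊔-ind P base step [] w′)

head-⊔ : ∀ v w → head (v ⊔ w) ≡ normalize (head (tail v ⊔ tail w)) (max (head v) (head w))
head-⊔ [] [] = sym (normalize-id (inj₁ refl))
head-⊔ (_ ∷ _) (_ ∷ _) = refl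
head-⊔ (_ ∷ _) [] = refl
head-⊔ [] (_ ∷ _) = refl

tail-⊔ : ∀ v w → tail (v ⊔ w) ≡ tail v ⊔ tail w
tail-⊔ [] [] = refl
tail-⊔ (_ ∷ _) (_ ∷ _) = refl
tail-⊔ (_ ∷ _) [] = refl
tail-⊔ [] (_ ∷ _) = refl

⊑-intro-⊔ : ∀ {u} v w → head u ≤ head (v ⊔ w) → tail u ⊑ tail v ⊔ tail w → u ⊑ v ⊔ w
⊑-intro-⊔ v w h t = ⊑-intro h (subst (_ ⊑_) (sym (tail-⊔ v w)) t)

head-≤-⊔ : ∀ {a} v w → a ≤ max (head v) (head w) → a ≤ head (v ⊔ w)
head-≤-⊔ v w a≤max = subst (_ ≤_) (sym (head-⊔ v w)) (≤-trans a≤max (≤-normalize (head (tail v ⊔ tail w)) _))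

⊑-⊔ˡ : ∀ v w → v ⊑ v ⊔ w
⊑-⊔ˡ = ⊔-ind (λ v w → v ⊑ v ⊔ w) []⊑ λ v w ih →
  ⊑-intro-⊔ v w (head-≤-⊔ v w (≤-maxˡ (head v) (head w))) ih

⊑-⊔ʳ : ∀ v w → w ⊑ v ⊔ w
⊑-⊔ʳ = ⊔-ind (λ v w → w ⊑ v ⊔ w) []⊑ λ v w ih →
  ⊑-intro-⊔ v w (head-≤-⊔ v w (≤-maxʳ (head v) (head w))) ih

⊔-least : ∀ v w {u} → NormalSeq u → v ⊑ u → w ⊑ u → v ⊔ w ⊑ u
⊔-least = ⊔-ind (λ v w → ∀ {u} → NormalSeq u → v ⊑ u → w ⊑ u → v ⊔ w ⊑ u)
  (λ _ _ _ → []⊑) λ v w ih nu v⊑u w⊑u →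
  let tail⊑ = ih (normalSeq-tail nu) (⊑-tail v⊑u) (⊑-tail w⊑u) in
  ⊑-intro (subst (_≤ _) (sym (head-⊔ v w))
             (normalize-least (max-elim (_≤ _) (⊑-head v⊑u) (⊑-head w⊑u))
                              (normal-antitone (⊑-head tail⊑) (normal-head nu))))
          (subst (_⊑ _) (sym (tail-⊔ v w)) tail⊑)

normal-head-⊔ : ∀ v w → Normal (head (tail (v ⊔ w))) (head (v ⊔ w))
normal-head-⊔ v w = subst₂ Normal (cong head (sym (tail-⊔ v w))) (sym (head-⊔ v w)) (normal-normalize _ _)

normalSeq-⊔ : ∀ v w → NormalSeq v → NormalSeq w → NormalSeq (v ⊔ w)
normalSeq-⊔ = ⊔-ind (λ v w → NormalSeq v → NormalSeq w → NormalSeq (v ⊔ w))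
  (λ _ _ → normalSeq-[]) λ v w ih nv nw →
  let nt = ih (normalSeq-tail nv) (normalSeq-tail nw) in
  normalSeq-intro
    (subst CNF (sym (head-⊔ v w)) (cnf-normalize (cnf-head nt) (max-elim CNF (cnf-head nv) (cnf-head nw))))
    (normal-head-⊔ v w)
    (subst NormalSeq (sym (tail-⊔ v w)) nt)

[]⊔ : ∀ w → NormalSeq w → [] ⊔ w ≡ w
[]⊔ [] _ = refl
[]⊔ (b ∷ w) nw rewrite []⊔ w (normalSeq-tail nw) | max-𝟎 b = cong (_∷ w) (normalize-id (normal-head nw))

cnf-e : ∀ n {α} → CNF α → CNF (e n α)
cnf-e zero cα = cα
cnf-e (suc n) {α} cα with e n α | cnf-e n cα
... | 𝟎 | _ = cnf0
... | ω^ _ + _ | c = cnf-ω^ c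

positive-e : ∀ n {α} → Positive α → Positive (e n α)
positive-e zero p = p
positive-e (suc n) {α} p with e n α | positive-e n p
... | ω^ _ + _ | _ = positive

e¹-positive : ∀ {a} → Positive a → e¹ a ≡ ω^⟨ a ⟩
e¹-positive positive = refl

e-suc : ∀ n {α} → Positive α → e (suc n) α ≡ ω^⟨ e n α ⟩
e-suc n p = e¹-positive (positive-e n p)

e-𝟎 : ∀ n → e n 𝟎 ≡ 𝟎
e-𝟎 zero = refl
e-𝟎 (suc n) rewrite e-𝟎 n = refl

-- The action of ⟨n^α⟩ on sequences: ⟨0^α⟩ adds ω^(v₁)·α to v₀, and
-- ⟨(n+1)^α⟩ acts with ⟨n^α⟩ on the tail and then adds ω^(new v₁) to v₀.

act : ℕ → O → List O → List O
act zero α v = (head v ⊕ ω^⟨ head (tail v) ⟩ ⊗ α) ∷ tail v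
act (suc n) α v = (head v ⊕ ω^⟨ head (act n α (tail v)) ⟩) ∷ act n α (tail v)

normalSeq-act : ∀ n {α v} → CNF α → NormalSeq v → NormalSeq (act n α v)
normalSeq-act zero {α} {v} cα nv =
  normalSeq-intro (cnf-⊕ (cnf-head nv) (cnf-ω^⊗ cv₁ cα)) normal₀ (normalSeq-tail nv)
  where
  cv₁ = cnf-head (normalSeq-tail nv)
  normal₀ : Normal (head (tail v)) (head v ⊕ ω^⟨ head (tail v) ⟩ ⊗ α)
  normal₀ with normal-head nv
  ... | inj₁ v₁≡𝟎 = inj₁ v₁≡𝟎
  ... | inj₂ (p , ev) = inj₂ (positive-⊕ˡ _ p , exps≥-⊕ (head v) ev (exps≥-ω^⊗ α cv₁))
normalSeq-act (suc n) {α} {v} cα nv =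
  normalSeq-intro (cnf-⊕ (cnf-head nv) (cnf-ω^ (cnf-head nu)))
                  (inj₂ (positive-⊕ʳ (head v) positive , exps≥-⊕ω^ (head v))) nu
  where nu = normalSeq-act n cα (normalSeq-tail nv)

positive-head-act : ∀ n {α} v → Positive α → Positive (head (act n α v))
positive-head-act zero v p = positive-⊕ʳ (head v) (positive-ω^⊗ (head (tail v)) p)
positive-head-act (suc n) v _ = positive-⊕ʳ (head v) positive

head<head-act : ∀ n {α} v → Positive α → head v < head (act n α v)
head<head-act zero v p = a<a⊕b (head v) (positive-ω^⊗ (head (tail v)) p)
head<head-act (suc n) v _ = a<a⊕b (head v) positive

at<at-act : ∀ n {α} v → Positive α → at v n < at (act n α v) n
at<at-act zero v p = head<head-act zero v p
at<at-act (suc n) v p = at<at-act n (tail v) p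

⊑-act : ∀ n {α} v → v ⊑ act n α v
⊑-act zero v = ⊑-intro (a≤a⊕b (head v) _) ⊑-refl
⊑-act (suc n) v = ⊑-intro (a≤a⊕b (head v) _) (⊑-act n (tail v))

act-mono : ∀ n {α v w} → CNF α → NormalSeq v → NormalSeq w → v ⊑ w → act n α v ⊑ act n α w
act-mono zero {α} {v} {w} cα nv nw v⊑w = ⊑-intro
  (≤-trans (⊕-monoˡ-≤ _ (cnf-head nv) (cnf-head nw) (cnf-ω^⊗ cv₁ cα) (⊑-head v⊑w))
           (⊕-monoʳ-≤ (head w) (cnf-ω^⊗ cv₁ cα) (cnf-ω^⊗ cw₁ cα) (ω^⊗-monoˡ-≤ α cv₁ cw₁ cα (v⊑w 1))))
  (⊑-tail v⊑w)
  where
  cv₁ = cnf-head (normalSeq-tail nv)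
  cw₁ = cnf-head (normalSeq-tail nw)
act-mono (suc n) {α} {v} {w} cα nv nw v⊑w = ⊑-intro
  (≤-trans (⊕-monoˡ-≤ _ (cnf-head nv) (cnf-head nw) (cnf-ω^ (cnf-head nu)) (⊑-head v⊑w))
           (⊕-monoʳ-≤ (head w) (cnf-ω^ (cnf-head nu)) (cnf-ω^ (cnf-head nu′)) (ω^-mono-≤ (⊑-head ih))))
  ih
  where
  nu  = normalSeq-act n cα (normalSeq-tail nv)
  nu′ = normalSeq-act n cα (normalSeq-tail nw)
  ih  = act-mono n cα (normalSeq-tail nv) (normalSeq-tail nw) (⊑-tail v⊑w)

act-monoʳ : ∀ n {α β v} → CNF α → CNF β → β ≤ α → NormalSeq v → act n β v ⊑ act n α v
act-monoʳ zero {α} {β} {v} cα cβ β≤α nv = ⊑-intro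
  (⊕-monoʳ-≤ (head v) (cnf-ω^⊗ cv₁ cβ) (cnf-ω^⊗ cv₁ cα) (ω^⊗-monoʳ-≤ (head (tail v)) cv₁ cβ cα β≤α))
  ⊑-refl
  where cv₁ = cnf-head (normalSeq-tail nv)
act-monoʳ (suc n) {α} {β} {v} cα cβ β≤α nv = ⊑-intro
  (⊕-monoʳ-≤ (head v) (cnf-ω^ (cnf-head (normalSeq-act n cβ nt))) (cnf-ω^ (cnf-head (normalSeq-act n cα nt)))
     (ω^-mono-≤ (⊑-head ih)))
  ih
  where
  nt = normalSeq-tail nv
  ih = act-monoʳ n cα cβ β≤α nt

act-⊕ : ∀ n {α β v} → CNF α → CNF β → Positive β → NormalSeq v → act n β (act n α v) ≡ act n (α ⊕ β) v
act-⊕ zero {α} {β} {v} cα cβ _ nv = cong (_∷ tail v) (begin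
  (head v ⊕ ω^⟨ v₁ ⟩ ⊗ α) ⊕ ω^⟨ v₁ ⟩ ⊗ β  ≡⟨ ⊕-assoc (head v) _ _ ⟩
  head v ⊕ (ω^⟨ v₁ ⟩ ⊗ α ⊕ ω^⟨ v₁ ⟩ ⊗ β)  ≡⟨ cong (head v ⊕_) (sym (ω^⊗-distribˡ-⊕ v₁ β (cnf-head (normalSeq-tail nv)) cα cβ)) ⟩
  head v ⊕ ω^⟨ v₁ ⟩ ⊗ (α ⊕ β)             ∎)
  where
  open ≡-Reasoning
  v₁ = head (tail v)
act-⊕ (suc n) {α} {β} {v} cα cβ pβ nv = begin
  (head v ⊕ ω^⟨ head u ⟩ ⊕ ω^⟨ head (act n β u) ⟩) ∷ act n β u
    ≡⟨ cong (_∷ act n β u) (⊕-assoc (head v) _ _) ⟩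
  (head v ⊕ (ω^⟨ head u ⟩ ⊕ ω^⟨ head (act n β u) ⟩)) ∷ act n β u
    ≡⟨ cong (λ x → (head v ⊕ x) ∷ act n β u) (⊕-lead< {head u} {𝟎} (head<head-act n u pβ)) ⟩
  (head v ⊕ ω^⟨ head (act n β u) ⟩) ∷ act n β u
    ≡⟨ cong (λ x → (head v ⊕ ω^⟨ head x ⟩) ∷ x) (act-⊕ n cα cβ pβ (normalSeq-tail nv)) ⟩
  (head v ⊕ ω^⟨ head (act n (α ⊕ β) (tail v)) ⟩) ∷ act n (α ⊕ β) (tail v) ∎
  where
  open ≡-Reasoning
  u = act n α (tail v)

head⊕e≤head-act : ∀ n {α v} → CNF α → Positive α → NormalSeq v → head v ⊕ e n α ≤ head (act n α v)
head⊕e≤head-act zero {α} {v} cα _ nv =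
  ⊕-monoʳ-≤ (head v) cα (cnf-ω^⊗ cv₁ cα) (γ≤ω^⊗γ cv₁ cα)
  where cv₁ = cnf-head (normalSeq-tail nv)
head⊕e≤head-act (suc n) {α} {v} cα pα nv rewrite e-suc n pα =
  ⊕-monoʳ-≤ (head v) (cnf-ω^ (cnf-e n cα)) (cnf-ω^ (cnf-head (normalSeq-act n cα nt)))
    (ω^-mono-≤ (≤-trans (b≤a⊕b (head (tail v)) (cnf-e n cα)) (head⊕e≤head-act n cα pα nt)))
  where nt = normalSeq-tail nv

act-e : ∀ m n {α v} → CNF α → Positive α → NormalSeq v → act m (e n α) v ⊑ act (m + n) α v
act-e m zero {α} {v} _ _ _ rewrite +-identityʳ m = ⊑-refl
act-e zero (suc n) {α} {v} cα pα nv rewrite e-suc n pα | ω^⊗ω^ (head (tail v)) (e n α) = ⊑-intro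
  (⊕-monoʳ-≤ (head v) (cnf-ω^ (cnf-⊕ (cnf-head nt) (cnf-e n cα))) (cnf-ω^ (cnf-head (normalSeq-act n cα nt)))
     (ω^-mono-≤ (head⊕e≤head-act n cα pα nt)))
  (⊑-act n (tail v))
  where nt = normalSeq-tail nv
act-e (suc m) (suc n) {α} {v} cα pα nv = ⊑-intro
  (⊕-monoʳ-≤ (head v) (cnf-ω^ (cnf-head (normalSeq-act m (cnf-e (suc n) cα) nt)))
     (cnf-ω^ (cnf-head (normalSeq-act (m + suc n) cα nt))) (ω^-mono-≤ (⊑-head ih)))
  ih
  where
  nt = normalSeq-tail nv
  ih = act-e m (suc n) cα pα nt

Tower : ℕ → O → List O → Set
Tower zero a v = head v ≡ a
Tower (suc n) a v = head v ≡ e¹ (head (tail v)) × Tower n a (tail v)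

head-tower : ∀ n {a v} → Tower n a v → head v ≡ e n a
head-tower zero t = t
head-tower (suc n) (h , t) = trans h (cong e¹ (head-tower n t))

tower-truncate : ∀ {m n a v} → m ≤ℕ n → Tower n a v → Tower m (e (n ∸ m) a) v
tower-truncate {n = n} z≤n t = head-tower n t
tower-truncate (s≤s m≤n) (h , t) = h , tower-truncate m≤n t

positive-head-tower : ∀ n {a v} → Positive a → Tower n a v → Positive (head v)
positive-head-tower n pa t rewrite head-tower n t = positive-e n pa

head-tower-suc : ∀ n {a v} → Positive a → Tower (suc n) a v → head v ≡ ω^⟨ head (tail v) ⟩
head-tower-suc n pa (h , t) = trans h (e¹-positive (positive-head-tower n pa t))

tower-act[] : ∀ n {α} → CNF α → Positive α → Tower n α (act n α [])
tower-act[] zero cα _ = one⊗ cα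
tower-act[] (suc n) cα pα = sym (e¹-positive (positive-head-act n [] pα)) , tower-act[] n cα pα

act[]⊑tower : ∀ n {α v} → CNF α → Positive α → Tower n α v → act n α [] ⊑ v
act[]⊑tower zero cα _ t = ⊑-intro (inj₂ (trans (one⊗ cα) (sym t))) []⊑
act[]⊑tower (suc n) {α} {v} cα pα t@(_ , t′) = ⊑-intro (inj₂ head≡) (act[]⊑tower n cα pα t′)
  where
  head≡ : ω^⟨ head (act n α []) ⟩ ≡ head v
  head≡ = begin
    ω^⟨ head (act n α []) ⟩  ≡⟨ cong ω^⟨_⟩ (head-tower n (tower-act[] n cα pα)) ⟩
    ω^⟨ e n α ⟩              ≡⟨ cong ω^⟨_⟩ (sym (head-tower n t′)) ⟩
    ω^⟨ head (tail v) ⟩      ≡⟨ sym (head-tower-suc n {v = v} pα t) ⟩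
    head v                   ∎
    where open ≡-Reasoning

tower-[] : ∀ n {a} → Tower n a [] → a ≡ 𝟎
tower-[] zero t = sym t
tower-[] (suc n) (_ , t) = tower-[] n t

-- Semantic form of the Schmerl axioms, with w = ⟦ψ⟧ for ψ in MNF headed at level n+1.
schmerl : ∀ n {c α w} → CNF c → Positive c → NormalSeq w → Tower (suc n) c w → CNF α → Positive α →
          act n α w ≡ act n (ω^⟨ c ⟩ ⊗ (one ⊕ α)) [] ⊔ w × Tower n (ω^⟨ c ⟩ ⊗ (one ⊕ α)) (act n α w)
schmerl n {w = []} _ pc _ t _ _ with () ← subst Positive (tower-[] (suc n) t) pc
schmerl zero {c} {α} {x ∷ w} cc pc nw t@(_ , refl) cα pα = act≡ , x⊕≡γ
  where
  γ = ω^⟨ c ⟩ ⊗ (one ⊕ α)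
  x⊕≡γ : x ⊕ ω^⟨ c ⟩ ⊗ α ≡ γ
  x⊕≡γ = begin
    x ⊕ ω^⟨ c ⟩ ⊗ α                    ≡⟨ cong (_⊕ ω^⟨ c ⟩ ⊗ α) (head-tower-suc zero {v = x ∷ w} pc t) ⟩
    ω^⟨ c ⟩ ⊕ ω^⟨ c ⟩ ⊗ α              ≡⟨ cong (_⊕ ω^⟨ c ⟩ ⊗ α) (sym (ω^⊗-identityʳ c)) ⟩
    ω^⟨ c ⟩ ⊗ one ⊕ ω^⟨ c ⟩ ⊗ α        ≡⟨ sym (ω^⊗-distribˡ-⊕ c α cc cnf-one cα) ⟩
    γ                                  ∎
    where open ≡-Reasoning
  normal-γ : Normal c γ
  normal-γ = inj₂ (positive-ω^⊗ c (positive-⊕ˡ α positive) , exps≥-ω^⊗ (one ⊕ α) cc)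
  x≤γ : x ≤ γ
  x≤γ = subst (x ≤_) x⊕≡γ (a≤a⊕b x _)
  act≡ : (x ⊕ ω^⟨ c ⟩ ⊗ α) ∷ w ≡ (one ⊗ γ ∷ []) ⊔ (x ∷ w)
  act≡ rewrite one⊗ (cnf-ω^⊗ cc (cnf-⊕ cnf-one cα)) | []⊔ w (normalSeq-tail nw) | max-≤ x≤γ
             | normalize-id normal-γ = cong (_∷ w) x⊕≡γ
schmerl (suc n) {c} {α} {x ∷ w} cc pc nw t@(_ , t′) cα pα = act≡ , x⊕≡ω^ , tower-u
  where
  γ = ω^⟨ c ⟩ ⊗ (one ⊕ α)
  u = act n α w
  u₀ = act n γ []
  ih = schmerl n cc pc (normalSeq-tail nw) t′ cα pα
  tower-u = proj₂ ih
  head-u₀ : head u₀ ≡ head u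
  head-u₀ = trans (head-tower n (tower-act[] n (cnf-ω^⊗ cc (cnf-⊕ cnf-one cα))
                                               (positive-ω^⊗ c (positive-⊕ˡ α positive))))
                  (sym (head-tower n tower-u))
  x≡ : x ≡ ω^⟨ head w ⟩
  x≡ = head-tower-suc (suc n) {v = x ∷ w} pc t
  x⊕ω^≡ω^ : x ⊕ ω^⟨ head u ⟩ ≡ ω^⟨ head u ⟩
  x⊕ω^≡ω^ rewrite x≡ = ⊕-lead< {head w} {𝟎} (head<head-act n w pα)
  x⊕≡ω^ : x ⊕ ω^⟨ head u ⟩ ≡ e¹ (head u)
  x⊕≡ω^ = trans x⊕ω^≡ω^ (sym (e¹-positive (positive-head-act n w pα)))
  x≤ω^ : x ≤ ω^⟨ head u ⟩
  x≤ω^ = subst (x ≤_) x⊕ω^≡ω^ (a≤a⊕b x _)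
  act≡ : (x ⊕ ω^⟨ head u ⟩) ∷ u ≡ (ω^⟨ head u₀ ⟩ ∷ u₀) ⊔ (x ∷ w)
  act≡ rewrite sym (proj₁ ih) | head-u₀ | max-≤ x≤ω^
             | normalize-id {head u} {ω^⟨ head u ⟩} (inj₂ (positive , expsω^ <-irrefl exps𝟎)) =
    cong (_∷ u) x⊕ω^≡ω^

⊕ω^⊕ω^-least : ∀ {s c a z} → s ⊕ ω^⟨ c ⟩ ≤ z → c < a → Exps≥ a z → (s ⊕ ω^⟨ c ⟩) ⊕ ω^⟨ a ⟩ ≤ z
⊕ω^⊕ω^-least {s} {c} {a} s⊕ω^≤z c<a ez rewrite ⊕-assoc s ω^⟨ c ⟩ ω^⟨ a ⟩ | ⊕-lead< {c} {𝟎} {a} {𝟎} c<a =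
  ⊕ω^-least (<-≤-trans (a<a⊕b s positive) s⊕ω^≤z) ez

-- The hypothesis on head x is where the successor exponent β+1 of the pull rule is needed.
act-suc-⊔ : ∀ n {α} p x → Positive α → act n α (tail p ⊔ tail x) ⊑ act n α (tail p) ⊔ tail x →
            (∃ λ s → head x ≡ s ⊕ ω^⟨ head (tail x) ⟩) → act (suc n) α (p ⊔ x) ⊑ act (suc n) α p ⊔ x
act-suc-⊔ n {α} p x pα tail⊑ (s , head-x≡) =
  ⊑-intro head≤ (subst (λ v → act n α v ⊑ tail (g ⊔ x)) (sym (tail-⊔ p x))
                       (subst (act n α q ⊑_) (sym (tail-⊔ g x)) tail⊑))
  where
  g = act (suc n) α p
  q = tail p ⊔ tail x
  a = head (act n α q)
  z = head (g ⊔ x)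
  q<a : head q < a
  q<a = head<head-act n q pα
  ez : Exps≥ a z
  ez = normal⇒exps≥ (normal-head-⊔ g x) (positive-head-act n q pα)
                    (subst (a ≤_) (cong head (sym (tail-⊔ g x))) (⊑-head tail⊑))
  p⊕≤z : head p ⊕ ω^⟨ a ⟩ ≤ z
  p⊕≤z = ⊕ω^-least (<-≤-trans (head<head-act (suc n) p pα) (head-≤-⊔ g x (≤-maxˡ (head g) (head x)))) ez
  x⊕≤z : head x ⊕ ω^⟨ a ⟩ ≤ z
  x⊕≤z rewrite head-x≡ =
    ⊕ω^⊕ω^-least {s} (subst (_≤ z) head-x≡ (head-≤-⊔ g x (≤-maxʳ (head g) (head x))))
                     (≤-<-trans (⊑-⊔ʳ (tail p) (tail x) 0) q<a) ez
  head≤ : head (p ⊔ x) ⊕ ω^⟨ head (act n α (tail (p ⊔ x))) ⟩ ≤ z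
  head≤ rewrite head-⊔ p x | tail-⊔ p x | normalize⊕ω^ {head q} (max (head p) (head x)) q<a =
    max-elim (λ t → t ⊕ ω^⟨ a ⟩ ≤ z) {head p} {head x} p⊕≤z x⊕≤z

head-act-⊕one : ∀ m {β} y → CNF β → NormalSeq y →
                ∃ λ s → head (act m (β ⊕ one) y) ≡ s ⊕ ω^⟨ head (tail (act m (β ⊕ one) y)) ⟩
head-act-⊕one zero {β} y cβ ny = head y ⊕ ω^⟨ y₁ ⟩ ⊗ β , (begin
  head y ⊕ ω^⟨ y₁ ⟩ ⊗ (β ⊕ one)              ≡⟨ cong (head y ⊕_) (ω^⊗-distribˡ-⊕ y₁ one cy₁ cβ cnf-one) ⟩
  head y ⊕ (ω^⟨ y₁ ⟩ ⊗ β ⊕ ω^⟨ y₁ ⟩ ⊗ one)   ≡⟨ cong (λ t → head y ⊕ (ω^⟨ y₁ ⟩ ⊗ β ⊕ t)) (ω^⊗-identityʳ y₁) ⟩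
  head y ⊕ (ω^⟨ y₁ ⟩ ⊗ β ⊕ ω^⟨ y₁ ⟩)         ≡⟨ sym (⊕-assoc (head y) _ _) ⟩
  head y ⊕ ω^⟨ y₁ ⟩ ⊗ β ⊕ ω^⟨ y₁ ⟩           ∎)
  where
  open ≡-Reasoning
  y₁ = head (tail y)
  cy₁ = cnf-head (normalSeq-tail ny)
head-act-⊕one (suc m) y _ _ = head y , refl

act-⊔-pull : ∀ m n {α β p y} → m <ℕ n → CNF α → Positive α → CNF β → NormalSeq p → NormalSeq y → y ⊑ p →
             act n α (p ⊔ act m (β ⊕ one) y) ⊑ act n α p ⊔ act m (β ⊕ one) y
act-⊔-pull zero (suc n) {α} {β} {p} {y} _ cα pα cβ np ny y⊑p =
  act-suc-⊔ n p (act zero (β ⊕ one) y) pα tail⊑ (head-act-⊕one zero y cβ ny)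
  where
  tail⊑ : act n α (tail p ⊔ tail y) ⊑ act n α (tail p) ⊔ tail y
  tail⊑ = ⊑-trans (act-mono n cα (normalSeq-⊔ (tail p) (tail y) (normalSeq-tail np) (normalSeq-tail ny))
                              (normalSeq-tail np)
                              (⊔-least (tail p) (tail y) (normalSeq-tail np) ⊑-refl (⊑-tail y⊑p)))
                  (⊑-⊔ˡ (act n α (tail p)) (tail y))
act-⊔-pull (suc m) (suc n) {α} {β} {p} {y} (s≤s m<n) cα pα cβ np ny y⊑p =
  act-suc-⊔ n p (act (suc m) (β ⊕ one) y) pα
    (act-⊔-pull m n m<n cα pα cβ (normalSeq-tail np) (normalSeq-tail ny) (⊑-tail y⊑p))
    (head-act-⊕one (suc m) y cβ ny)

-- ⟨n^0⟩ acts as the identity, matching the convention ◇ n 𝟎 φ = φ.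
Act : ℕ → O → List O → List O
Act n 𝟎 v = v
Act n α@(ω^ _ + _) v = act n α v

Act-positive : ∀ n {α} v → Positive α → Act n α v ≡ act n α v
Act-positive n v positive = refl

normalSeq-Act : ∀ n {α v} → CNF α → NormalSeq v → NormalSeq (Act n α v)
normalSeq-Act n {𝟎} _ nv = nv
normalSeq-Act n {ω^ _ + _} cα nv = normalSeq-act n cα nv

⊑-Act : ∀ n α v → v ⊑ Act n α v
⊑-Act n 𝟎 v = ⊑-refl
⊑-Act n (ω^ _ + _) v = ⊑-act n v

Act-mono : ∀ n {α v w} → CNF α → NormalSeq v → NormalSeq w → v ⊑ w → Act n α v ⊑ Act n α w
Act-mono n {𝟎} _ _ _ v⊑w = v⊑w
Act-mono n {ω^ _ + _} cα nv nw v⊑w = act-mono n cα nv nw v⊑w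

Act-monoʳ : ∀ n {α β v} → CNF α → CNF β → β ≤ α → NormalSeq v → Act n β v ⊑ Act n α v
Act-monoʳ n {α} {𝟎} {v} _ _ _ _ = ⊑-Act n α v
Act-monoʳ n {𝟎} {ω^ _ + _} _ _ (inj₁ ()) _
Act-monoʳ n {ω^ _ + _} {ω^ _ + _} cα cβ β≤α nv = act-monoʳ n cα cβ β≤α nv

Act-⊕ : ∀ n {α β v} → CNF α → CNF β → NormalSeq v → Act n β (Act n α v) ≡ Act n (α ⊕ β) v
Act-⊕ n {𝟎} _ _ _ = refl
Act-⊕ n {ω^ _ + _} {𝟎} _ _ _ = refl
Act-⊕ n {α@(ω^ _ + _)} {β@(ω^ _ + _)} {v} cα cβ nv =
  trans (act-⊕ n cα cβ positive nv) (sym (Act-positive n v (positive-⊕ˡ β positive)))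

Act-e : ∀ m n {α v} → CNF α → NormalSeq v → Act m (e n α) v ⊑ Act (m + n) α v
Act-e m n {𝟎} _ _ rewrite e-𝟎 n = ⊑-refl
Act-e m n {α@(ω^ a + b)} {v} cα nv =
  subst (_⊑ act (m + n) α v) (sym (Act-positive m v (positive-e n (positive {a} {b})))) (act-e m n cα positive nv)

⟦_⟧ : F → List O
⟦ ⊤' ⟧ = []
⟦ φ ∧ ψ ⟧ = ⟦ φ ⟧ ⊔ ⟦ ψ ⟧
⟦ ⟨ n ^ α ⟩ φ ⟧ = Act n α ⟦ φ ⟧

⟦◇⟧ : ∀ n α φ → ⟦ ◇ n α φ ⟧ ≡ Act n α ⟦ φ ⟧
⟦◇⟧ n 𝟎 φ = refl
⟦◇⟧ n (ω^ _ + _) φ = refl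

normalSeq-⟦⟧ : ∀ {φ} → WF φ → NormalSeq ⟦ φ ⟧
normalSeq-⟦⟧ wf⊤ = normalSeq-[]
normalSeq-⟦⟧ (wf∧ {φ} {ψ} wφ wψ) = normalSeq-⊔ ⟦ φ ⟧ ⟦ ψ ⟧ (normalSeq-⟦⟧ wφ) (normalSeq-⟦⟧ wψ)
normalSeq-⟦⟧ (wf◇ {n} cα _ wφ) = normalSeq-Act n cα (normalSeq-⟦⟧ wφ)

wf-◇ : ∀ {n α φ} → CNF α → WF φ → WF (◇ n α φ)
wf-◇ {α = 𝟎} _ wφ = wφ
wf-◇ {α = ω^ _ + _} cα wφ = wf◇ cα refl wφ

positive⇒>ₒ𝟎 : ∀ {a} → Positive a → 𝟎 <ₒ a
positive⇒>ₒ𝟎 positive = refl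

head-exponent : ∀ {n₀ α₀ ψ} → Head n₀ α₀ ψ → WF ψ → CNF α₀ × Positive α₀
head-exponent hd-mono (wf◇ cα₀ p _) = cα₀ , >ₒ𝟎⇒positive p
head-exponent (hd-conj _) (wf∧ (wf◇ cα₀ p _) _) = cα₀ , >ₒ𝟎⇒positive p

∸-suc : ∀ {n n₀} → n <ℕ n₀ → n₀ ∸ n ≡ suc (n₀ ∸ suc n)
∸-suc (s≤s z≤n) = refl
∸-suc (s≤s (s≤s n<n₀)) = ∸-suc (s≤s n<n₀)

e-∸ : ∀ {n n₀ α} → n <ℕ n₀ → Positive α → e (n₀ ∸ n) α ≡ ω^⟨ e (n₀ ∸ suc n) α ⟩
e-∸ {n} {n₀} {α} n<n₀ pα = trans (cong (λ k → e k α) (∸-suc n<n₀)) (e-suc (n₀ ∸ suc n) pα)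

cnf-schmerl : ∀ {n n₀ α₀ α} → n <ℕ n₀ → CNF α₀ → Positive α₀ → CNF α →
              CNF (e (n₀ ∸ n) α₀ ⊗ (one ⊕ α)) × Positive (e (n₀ ∸ n) α₀ ⊗ (one ⊕ α))
cnf-schmerl {n} {n₀} {α₀} {α} n<n₀ cα₀ pα₀ cα rewrite e-∸ n<n₀ pα₀ =
  cnf-ω^⊗ (cnf-e (n₀ ∸ suc n) cα₀) (cnf-⊕ cnf-one cα) , positive-ω^⊗ _ (positive-⊕ˡ α positive)

two⊕ : ∀ β → two ⊕ β ≡ one ⊕ (one ⊕ β)
two⊕ β = ⊕-assoc one one β

wf-mnf : ∀ {ψ} → MNF ψ → WF ψ
wf-mnf mnf⊤ = wf⊤
wf-mnf (mnfMono _ _ cα p) = wf◇ cα p wf⊤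
wf-mnf (mnfCons _ _ _ β m h n<n₀ cβ) rewrite two⊕ β with head-exponent h (wf-mnf m)
... | cα₀ , pα₀ with cnf-schmerl n<n₀ cα₀ pα₀ (cnf-⊕ cnf-one cβ)
...   | cγ , pγ = wf∧ (wf◇ cγ (positive⇒>ₒ𝟎 pγ) wf⊤) (wf-mnf m)

wf-schmerl : ∀ {n n₀ α₀ α ψ} → MNF ψ → Head n₀ α₀ ψ → n <ℕ n₀ → CNF α →
             WF (◇ n (e (n₀ ∸ n) α₀ ⊗ (one ⊕ α)) ⊤' ∧ ψ)
wf-schmerl m h n<n₀ cα with head-exponent h (wf-mnf m)
... | cα₀ , pα₀ = wf∧ (wf-◇ (proj₁ (cnf-schmerl n<n₀ cα₀ pα₀ cα)) wf⊤) (wf-mnf m)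

schmerl-tower : ∀ {n n₀ α₀ α w} → n <ℕ n₀ → CNF α₀ → Positive α₀ → NormalSeq w → Tower n₀ α₀ w →
                CNF α → Positive α →
                act n α w ≡ act n (e (n₀ ∸ n) α₀ ⊗ (one ⊕ α)) [] ⊔ w
                × Tower n (e (n₀ ∸ n) α₀ ⊗ (one ⊕ α)) (act n α w)
schmerl-tower {n} {n₀} n<n₀ cα₀ pα₀ nw t cα pα rewrite e-∸ n<n₀ pα₀ =
  schmerl n (cnf-e (n₀ ∸ suc n) cα₀) (positive-e (n₀ ∸ suc n) pα₀) nw (tower-truncate n<n₀ t) cα pα

tower-⟦mnf⟧ : ∀ {n₀ α₀ ψ} → MNF ψ → Head n₀ α₀ ψ → Tower n₀ α₀ ⟦ ψ ⟧
tower-⟦mnf⟧ (mnfMono n (ω^ _ + _) cα _) hd-mono = tower-act[] n cα positive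
tower-⟦mnf⟧ (mnfCons {ψ} n _ _ β m h n<n₀ cβ) (hd-conj _) rewrite two⊕ β with head-exponent h (wf-mnf m)
... | cα₀ , pα₀ rewrite Act-positive n [] (proj₂ (cnf-schmerl n<n₀ cα₀ pα₀ (cnf-⊕ cnf-one cβ))) =
  subst (Tower n _) (proj₁ S) (proj₂ S)
  where
  S = schmerl-tower n<n₀ cα₀ pα₀ (normalSeq-⟦⟧ (wf-mnf m)) (tower-⟦mnf⟧ m h) (cnf-⊕ cnf-one cβ) (positive-⊕ˡ β positive)

schmerl-sound : ∀ {n n₀ α₀ α ψ} → MNF ψ → Head n₀ α₀ ψ → n <ℕ n₀ → CNF α →
                Act n α ⟦ ψ ⟧ ⊑ Act n (e (n₀ ∸ n) α₀ ⊗ (one ⊕ α)) [] ⊔ ⟦ ψ ⟧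
                × Act n (e (n₀ ∸ n) α₀ ⊗ (one ⊕ α)) [] ⊔ ⟦ ψ ⟧ ⊑ Act n α ⟦ ψ ⟧
schmerl-sound {n} {n₀} {α₀} {α} {ψ} m h n<n₀ cα with head-exponent h (wf-mnf m)
... | cα₀ , pα₀ = sound-for α cα
  where
  nψ = normalSeq-⟦⟧ (wf-mnf m)
  sound-for : ∀ α → CNF α → Act n α ⟦ ψ ⟧ ⊑ Act n (e (n₀ ∸ n) α₀ ⊗ (one ⊕ α)) [] ⊔ ⟦ ψ ⟧
                            × Act n (e (n₀ ∸ n) α₀ ⊗ (one ⊕ α)) [] ⊔ ⟦ ψ ⟧ ⊑ Act n α ⟦ ψ ⟧
  sound-for 𝟎 _ rewrite e-∸ n<n₀ pα₀ | ω^⊗-identityʳ (e (n₀ ∸ suc n) α₀) =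
    ⊑-⊔ʳ _ ⟦ ψ ⟧ ,
    ⊔-least _ ⟦ ψ ⟧ nψ (act[]⊑tower n (cnf-ω^ (cnf-e (n₀ ∸ suc n) cα₀)) positive tower) ⊑-refl
    where
    tower : Tower n ω^⟨ e (n₀ ∸ suc n) α₀ ⟩ ⟦ ψ ⟧
    tower = subst (λ a → Tower n a ⟦ ψ ⟧) (e-∸ n<n₀ pα₀) (tower-truncate (<⇒≤ n<n₀) (tower-⟦mnf⟧ m h))
  sound-for α@(ω^ _ + _) cα
    rewrite Act-positive n [] (proj₂ (cnf-schmerl {n} {n₀} {α₀} {α} n<n₀ cα₀ pα₀ cα)) =
    ⊑-reflexive act≡ , ⊑-reflexive (sym act≡)
    where act≡ = proj₁ (schmerl-tower n<n₀ cα₀ pα₀ nψ (tower-⟦mnf⟧ m h) cα positive)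

wf-⊢ : ∀ {φ ψ} → φ ⊢ ψ → WF φ × WF ψ
wf-⊢ (ax-id wφ) = wφ , wφ
wf-⊢ (ax-top wφ) = wφ , wf⊤
wf-⊢ (ax-∧l wφ wψ) = wf∧ wφ wψ , wφ
wf-⊢ (ax-∧r wφ wψ) = wf∧ wφ wψ , wψ
wf-⊢ (ax-mon cα cβ wφ _) = wf-◇ cα wφ , wf-◇ cβ wφ
wf-⊢ (ax-add₁ cα cβ wφ) = wf-◇ (cnf-⊕ cα cβ) wφ , wf-◇ cβ (wf-◇ cα wφ)
wf-⊢ (ax-add₂ cα cβ wφ) = wf-◇ cβ (wf-◇ cα wφ) , wf-◇ (cnf-⊕ cα cβ) wφ
wf-⊢ (ax-red {n = n} cα wφ) = wf-◇ cα wφ , wf-◇ (cnf-e n cα) wφ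
wf-⊢ (ax-sch₁ m h n<n₀ cα) = wf-◇ cα (wf-mnf m) , wf-schmerl m h n<n₀ cα
wf-⊢ (ax-sch₂ m h n<n₀ cα) = wf-schmerl m h n<n₀ cα , wf-◇ cα (wf-mnf m)
wf-⊢ (r-∧ d₁ d₂) = proj₁ (wf-⊢ d₁) , wf∧ (proj₂ (wf-⊢ d₁)) (proj₂ (wf-⊢ d₂))
wf-⊢ (r-cut d₁ d₂) = proj₁ (wf-⊢ d₁) , proj₂ (wf-⊢ d₂)
wf-⊢ (r-nec cα d) = wf-◇ cα (proj₁ (wf-⊢ d)) , wf-◇ cα (proj₂ (wf-⊢ d))
wf-⊢ (r-pull {β = β} cα cβ _ d) = wf∧ (wf-◇ cα wφ) wχ , wf-◇ cα (wf∧ wφ wχ)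
  where
  wφ = proj₁ (wf-⊢ d)
  wχ = wf◇ (cnf-⊕ cβ cnf-one) (positive⇒>ₒ𝟎 (positive-⊕ʳ β positive)) (proj₂ (wf-⊢ d))

sound : ∀ {φ ψ} → φ ⊢ ψ → ⟦ ψ ⟧ ⊑ ⟦ φ ⟧
sound (ax-id _) = ⊑-refl
sound (ax-top _) = []⊑
sound (ax-∧l {φ} {ψ} _ _) = ⊑-⊔ˡ ⟦ φ ⟧ ⟦ ψ ⟧
sound (ax-∧r {φ} {ψ} _ _) = ⊑-⊔ʳ ⟦ φ ⟧ ⟦ ψ ⟧
sound (ax-mon {n} {α} {β} {φ} cα cβ wφ β≤α) rewrite ⟦◇⟧ n α φ | ⟦◇⟧ n β φ =
  Act-monoʳ n cα cβ (≤ₒ⇒≤ β≤α) (normalSeq-⟦⟧ wφ)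
sound (ax-add₁ {n} {α} {β} {φ} cα cβ wφ) rewrite ⟦◇⟧ n β (◇ n α φ) | ⟦◇⟧ n α φ | ⟦◇⟧ n (α ⊕ β) φ =
  ⊑-reflexive (Act-⊕ n cα cβ (normalSeq-⟦⟧ wφ))
sound (ax-add₂ {n} {α} {β} {φ} cα cβ wφ) rewrite ⟦◇⟧ n β (◇ n α φ) | ⟦◇⟧ n α φ | ⟦◇⟧ n (α ⊕ β) φ =
  ⊑-reflexive (sym (Act-⊕ n cα cβ (normalSeq-⟦⟧ wφ)))
sound (ax-red {m} {n} {α} {φ} cα wφ) rewrite ⟦◇⟧ (m + n) α φ | ⟦◇⟧ m (e n α) φ =
  Act-e m n cα (normalSeq-⟦⟧ wφ)
sound (ax-sch₁ {n} {n₀} {α₀} {α} {ψ} m h n<n₀ cα)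
  rewrite ⟦◇⟧ n α ψ | ⟦◇⟧ n (e (n₀ ∸ n) α₀ ⊗ (one ⊕ α)) ⊤' = proj₂ (schmerl-sound m h n<n₀ cα)
sound (ax-sch₂ {n} {n₀} {α₀} {α} {ψ} m h n<n₀ cα)
  rewrite ⟦◇⟧ n α ψ | ⟦◇⟧ n (e (n₀ ∸ n) α₀ ⊗ (one ⊕ α)) ⊤' = proj₁ (schmerl-sound m h n<n₀ cα)
sound (r-∧ {φ} {ψ} {χ} d₁ d₂) = ⊔-least ⟦ ψ ⟧ ⟦ χ ⟧ (normalSeq-⟦⟧ (proj₁ (wf-⊢ d₁))) (sound d₁) (sound d₂)
sound (r-cut d₁ d₂) = ⊑-trans (sound d₂) (sound d₁)
sound (r-nec {n} {α} {φ} {ψ} cα d) rewrite ⟦◇⟧ n α φ | ⟦◇⟧ n α ψ =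
  Act-mono n cα (normalSeq-⟦⟧ (proj₂ (wf-⊢ d))) (normalSeq-⟦⟧ (proj₁ (wf-⊢ d))) (sound d)
sound (r-pull {n} {m} {α} {β} {φ} {ψ} cα cβ m<n d)
  rewrite ⟦◇⟧ n α φ | ⟦◇⟧ n α (φ ∧ ⟨ m ^ β ⊕ one ⟩ ψ) | Act-positive m ⟦ ψ ⟧ (positive-⊕ʳ β (positive {𝟎} {𝟎})) =
  pull-for α cα
  where
  pull-for : ∀ α → CNF α → Act n α (⟦ φ ⟧ ⊔ act m (β ⊕ one) ⟦ ψ ⟧) ⊑ Act n α ⟦ φ ⟧ ⊔ act m (β ⊕ one) ⟦ ψ ⟧
  pull-for 𝟎 _ = ⊑-refl
  pull-for (ω^ _ + _) cα = act-⊔-pull m n m<n cα positive cβ (normalSeq-⟦⟧ (proj₁ (wf-⊢ d)))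
                                       (normalSeq-⟦⟧ (proj₂ (wf-⊢ d))) (sound d)

corollary6p15 : (φ : F) (n : ℕ) (α : O) → WF φ → CNF α → 𝟎 <ₒ α →
    ¬ (φ ⊢ ⟨ n ^ α ⟩ φ)
corollary6p15 φ n 𝟎 _ _ () _
corollary6p15 φ n (ω^ _ + _) _ _ _ φ⊢◇φ = ≤⇒≯ (sound φ⊢◇φ n) (at<at-act n ⟦ φ ⟧ positive)
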